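{- Let $G$ be a non-complete graph on $n\ge 5$ vertices. Then $G$ is $(n-1)$-critical if and only if $G$ is $(I_3,2K_2)$-free and, for every edge $e$ of $G$, the graph $G-e$ contains an induced $I_3$ or an induced $2K_2$.
   Context: Standing assumption of the paper: all graphs are finite, undirected, simple and connected. A star coloring of $G$ is a proper vertex-coloring such that no path on four vertices (as a subgraph) is colored with only two colors; $\chi_s(G)$ is the minimum number of colors in a star coloring of $G$. $G$ is $k$-critical if $\chi_s(G)=k$ and $\chi_s(G-e)<\chi_s(G)$ for every edge $e$, where $G-e$ denotes deletion of the edge $e$. $I_3$ is the edgeless graph on three vertices; $2K_2$ is the disjoint union of two edges. $G$ is $(H_1,H_2)$-free if it contains neither $H_1$ nor $H_2$ as an induced subgraph. -}

module Defs where

open import Data.Nat using (ℕ; _<_)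
open import Data.Fin using (Fin)
open import Data.Product using (Σ; _×_; ∃; ∃-syntax; _,_)
open import Data.Sum using (_⊎_)
open import Relation.Nullary using (¬_; Dec)
open import Relation.Binary.PropositionalEquality using (_≡_; _≢_)
open import Level using (0ℓ)

record Graph (n : ℕ) : Set₁ where
  field
    Adj    : Fin n → Fin n → Set
    sym    : ∀ {u v} → Adj u v → Adj v u
    irrefl : ∀ {u} → ¬ Adj u u
    dec    : ∀ u v → Dec (Adj u v)
open Graph public

data Reach {n : ℕ} (G : Graph n) : Fin n → Fin n → Set where
  here : ∀ {u} → Reach G u u
  step : ∀ {u v w} → Adj G u v → Reach G v w → Reach G u w

Connected : ∀ {n} → Graph n → Set
Connected G = ∀ u v → Reach G u v

Complete : ∀ {n} → Graph n → Set
Complete G = ∀ u v → u ≢ v → Adj G u v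

deleteEdge : ∀ {n} (G : Graph n) (x y : Fin n) → Adj G x y → Graph n
deleteEdge {n} G x y _ = record
  { Adj    = A
  ; sym    = λ { (a , ne) → sym G a , λ { (Data.Sum.inj₁ (p , q)) → ne (Data.Sum.inj₂ (q , p))
                                        ; (Data.Sum.inj₂ (p , q)) → ne (Data.Sum.inj₁ (q , p)) } }
  ; irrefl = λ { (a , _) → irrefl G a }
  ; dec    = λ u v → decA u v
  }
  where
  open import Data.Fin using (_≟_)
  open import Relation.Nullary using (yes; no)
  open import Data.Sum using (inj₁; inj₂)
  IsE : Fin n → Fin n → Set
  IsE u v = (u ≡ x × v ≡ y) ⊎ (u ≡ y × v ≡ x)
  A : Fin n → Fin n → Set
  A u v = Adj G u v × ¬ IsE u v
  decE : ∀ u v → Dec (IsE u v)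
  decE u v with u ≟ x | v ≟ y | u ≟ y | v ≟ x
  ... | yes p | yes q | _ | _ = yes (inj₁ (p , q))
  ... | _ | _ | yes p | yes q = yes (inj₂ (p , q))
  ... | no ¬p | _ | no ¬r | _ = no λ { (inj₁ (p , _)) → ¬p p ; (inj₂ (r , _)) → ¬r r }
  ... | no ¬p | _ | yes _ | no ¬s = no λ { (inj₁ (p , _)) → ¬p p ; (inj₂ (_ , s)) → ¬s s }
  ... | yes _ | no ¬q | no ¬r | _ = no λ { (inj₁ (_ , q)) → ¬q q ; (inj₂ (r , _)) → ¬r r }
  ... | yes _ | no ¬q | yes _ | no ¬s = no λ { (inj₁ (_ , q)) → ¬q q ; (inj₂ (_ , s)) → ¬s s }
  decA : ∀ u v → Dec (A u v)
  decA u v with dec G u v | decE u v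
  ... | yes a | no ne = yes (a , ne)
  ... | no na | _ = no λ { (a , _) → na a }
  ... | yes _ | yes e = no λ { (_ , ne) → ne e }

ProperColoring : ∀ {n k} → Graph n → (Fin n → Fin k) → Set
ProperColoring G c = ∀ u v → Adj G u v → c u ≢ c v

IsP4 : ∀ {n} → Graph n → Fin n → Fin n → Fin n → Fin n → Set
IsP4 G a b c d =
  a ≢ b × a ≢ c × a ≢ d × b ≢ c × b ≢ d × c ≢ d ×
  Adj G a b × Adj G b c × Adj G c d

TwoColored : ∀ {n k} → (Fin n → Fin k) → Fin n → Fin n → Fin n → Fin n → Set
TwoColored {k = k} col a b c d =
  ∃[ x ] ∃[ y ] (In x y (col a) × In x y (col b) × In x y (col c) × In x y (col d))
  where
  In : Fin k → Fin k → Fin k → Set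
  In x y z = z ≡ x ⊎ z ≡ y

StarColoring : ∀ {n k} → Graph n → (Fin n → Fin k) → Set
StarColoring G col =
  ProperColoring G col ×
  (∀ a b c d → IsP4 G a b c d → ¬ TwoColored col a b c d)

StarColorable : ∀ {n} → Graph n → ℕ → Set
StarColorable {n} G k = Σ (Fin n → Fin k) (StarColoring G)

StarChromatic : ∀ {n} → Graph n → ℕ → Set
StarChromatic G k = StarColorable G k × (∀ m → m < k → ¬ StarColorable G m)

Critical : ∀ {n} → Graph n → ℕ → Set
Critical G k =
  StarChromatic G k ×
  (∀ x y (e : Adj G x y) → ∃[ m ] (m < k × StarChromatic (deleteEdge G x y e) m))

HasInducedI3 : ∀ {n} → Graph n → Set
HasInducedI3 G = ∃[ a ] ∃[ b ] ∃[ c ]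
  (a ≢ b × a ≢ c × b ≢ c × ¬ Adj G a b × ¬ Adj G a c × ¬ Adj G b c)

HasInduced2K2 : ∀ {n} → Graph n → Set
HasInduced2K2 G = ∃[ a ] ∃[ b ] ∃[ c ] ∃[ d ]
  (a ≢ b × a ≢ c × a ≢ d × b ≢ c × b ≢ d × c ≢ d ×
   Adj G a b × Adj G c d ×
   ¬ Adj G a c × ¬ Adj G a d × ¬ Adj G b c × ¬ Adj G b d)

I3-2K2-Free : ∀ {n} → Graph n → Set
I3-2K2-Free G = ¬ HasInducedI3 G × ¬ HasInduced2K2 G

{-# OPTIONS --safe #-}
-- On n vertices, χ_s(G) ≤ n − 1 unless G is complete (merge a non-adjacent
-- pair), and χ_s(G) ≤ n − 2 exactly when G has an induced I3 or 2K2. Merging an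
-- independent triple into one color class, or a 2K2 ab, cd into the classes
-- {a, c} and {b, d}, creates no two-colored P4;
-- conversely, n − 2 colors on n vertices give by pigeonhole either a color
-- class of size three, which is an induced I3, or two disjoint two-element
-- classes, whose four vertices induce an I3 or a 2K2 unless they contain a
-- two-colored P4. Deleting an edge lowers χ_s by at most one (recolor an
-- endpoint with a fresh color), so G is (n − 1)-critical iff χ_s(G) = n − 1 and
-- χ_s(G − e) ≤ n − 2 for every edge e.

module Submission where

open import Defs renaming (sym to Adj-sym)
open import Data.Nat using (ℕ; zero; suc; _≤_; _<_; _∸_; s≤s; s≤s⁻¹)
open import Data.Nat.Properties using (n<1+n; n≤1+n)
open import Data.Fin using (Fin; fromℕ; inject₁; inject≤; punchIn; punchOut; _≟_)
open import Data.Fin.Properties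
  using (pigeonhole; <⇒≢; punchOut-injective; punchIn-injective; punchInᵢ≢i;
         inject≤-injective; inject₁-injective; fromℕ≢inject₁; any?)
open import Data.List using (List; []; _∷_; map)
open import Data.List.Relation.Unary.Any using (here; there)
open import Data.List.Membership.Propositional using (_∈_)
open import Data.List.Membership.Propositional.Properties using (∈-map⁻)
open import Data.Product using (_×_; _,_; ∃-syntax)
open import Data.Sum using (_⊎_; inj₁; inj₂; [_,_])
open import Data.Empty using (⊥; ⊥-elim)
open import Function using (_∘_)
open import Function.Definitions using (Injective)
open import Function.Bundles using (_⇔_; mk⇔)
open import Relation.Nullary using (¬_; Dec; yes; no)
open import Relation.Nullary.Decidable using (¬?; _×-dec_)
open import Relation.Binary.PropositionalEquality
  using (_≡_; _≢_; refl; sym; trans; cong; ≢-sym)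

-- Star colorings as colorings without alternating P4s

NoAlternatingP4 : ∀ {n k} → Graph n → (Fin n → Fin k) → Set
NoAlternatingP4 G col =
  ∀ a b c d → IsP4 G a b c d → col a ≡ col c → col b ≡ col d → ⊥

twoValued-ends-≡ : ∀ {A : Set} {x y u v w : A} →
  (u ≡ x ⊎ u ≡ y) → (v ≡ x ⊎ v ≡ y) → (w ≡ x ⊎ w ≡ y) → u ≢ v → v ≢ w → u ≡ w
twoValued-ends-≡ (inj₁ u≡x) (inj₁ v≡x) _ u≢v _ = ⊥-elim (u≢v (trans u≡x (sym v≡x)))
twoValued-ends-≡ (inj₁ u≡x) (inj₂ _) (inj₁ w≡x) _ _ = trans u≡x (sym w≡x)
twoValued-ends-≡ (inj₁ _) (inj₂ v≡y) (inj₂ w≡y) _ v≢w = ⊥-elim (v≢w (trans v≡y (sym w≡y)))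
twoValued-ends-≡ (inj₂ _) (inj₁ v≡x) (inj₁ w≡x) _ v≢w = ⊥-elim (v≢w (trans v≡x (sym w≡x)))
twoValued-ends-≡ (inj₂ u≡y) (inj₁ _) (inj₂ w≡y) _ _ = trans u≡y (sym w≡y)
twoValued-ends-≡ (inj₂ u≡y) (inj₂ v≡y) _ u≢v _ = ⊥-elim (u≢v (trans u≡y (sym v≡y)))

module _ {n k : ℕ} (G : Graph n) (col : Fin n → Fin k) where

  starColoring : ProperColoring G col → NoAlternatingP4 G col → StarColoring G col
  starColoring proper noAlt = proper , notTwoColored
    where
    notTwoColored : ∀ a b c d → IsP4 G a b c d → ¬ TwoColored col a b c d
    notTwoColored a b c d p4@(_ , _ , _ , _ , _ , _ , ab , bc , cd) (_ , _ , ∈a , ∈b , ∈c , ∈d) =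
      noAlt a b c d p4 (twoValued-ends-≡ ∈a ∈b ∈c (proper a b ab) (proper b c bc))
                       (twoValued-ends-≡ ∈b ∈c ∈d (proper b c bc) (proper c d cd))

  starColoring⇒noAlternatingP4 : StarColoring G col → NoAlternatingP4 G col
  starColoring⇒noAlternatingP4 (_ , noTwoColored) a b c d p4 ac bd =
    noTwoColored a b c d p4 (col a , col b , inj₁ refl , inj₂ refl , inj₁ (sym ac) , inj₂ (sym bd))

  starColoring-byKernel : (R : Fin n → Fin n → Set) →
    (∀ u v → col u ≡ col v → u ≡ v ⊎ R u v) →
    (∀ u v → R u v → ¬ Adj G u v) →
    (∀ a b c d → IsP4 G a b c d → R a c → R b d → ⊥) →
    StarColoring G col
  starColoring-byKernel R kernel R-nonadjacent R-noP4 = starColoring proper noAlt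
    where
    proper : ProperColoring G col
    proper u v uv eq with kernel u v eq
    ... | inj₁ refl = irrefl G uv
    ... | inj₂ Ruv = R-nonadjacent u v Ruv uv
    noAlt : NoAlternatingP4 G col
    noAlt a b c d p4@(_ , a≢c , _ , _ , b≢d , _) ac bd with kernel a c ac | kernel b d bd
    ... | inj₁ a≡c | _ = a≢c a≡c
    ... | inj₂ _ | inj₁ b≡d = b≢d b≡d
    ... | inj₂ Rac | inj₂ Rbd = R-noP4 a b c d p4 Rac Rbd

module _ {n : ℕ} (G : Graph n) where

  starColoring-∘-injective : ∀ {k m} {col : Fin n → Fin k} (f : Fin k → Fin m) →
    Injective _≡_ _≡_ f → StarColoring G col → StarColoring G (f ∘ col)
  starColoring-∘-injective {col = col} f f-injective star@(proper , _) =
    starColoring-byKernel G (f ∘ col) (λ u v → col u ≡ col v)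
      (λ _ _ eq → inj₂ (f-injective eq))
      (λ u v eq uv → proper u v uv eq)
      (starColoring⇒noAlternatingP4 G col star)

  starColorable-mono : ∀ {k m} → k ≤ m → StarColorable G k → StarColorable G m
  starColorable-mono k≤m (col , star) =
    (λ v → inject≤ (col v) k≤m) ,
    starColoring-∘-injective (λ i → inject≤ i k≤m) (inject≤-injective k≤m k≤m _ _) star

-- One extra color pays for an edge

module FreshColor {n k : ℕ} (x : Fin n) (col : Fin n → Fin k) where

  recolor : Fin n → Fin (suc k)
  recolor v with v ≟ x
  ... | yes _ = fromℕ k
  ... | no _ = inject₁ (col v)

  recolor-kernel : ∀ u v → recolor u ≡ recolor v →
    u ≡ v ⊎ (u ≢ x × v ≢ x × col u ≡ col v)
  recolor-kernel u v eq with u ≟ x | v ≟ x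
  ... | yes refl | yes refl = inj₁ refl
  ... | yes _ | no _ = ⊥-elim (fromℕ≢inject₁ eq)
  ... | no _ | yes _ = ⊥-elim (fromℕ≢inject₁ (sym eq))
  ... | no u≢x | no v≢x = inj₂ (u≢x , v≢x , inject₁-injective eq)

starColorable-freshColor : ∀ {n k} (G H : Graph n) (x : Fin n) →
  (∀ u v → u ≢ x → v ≢ x → Adj G u v → Adj H u v) →
  StarColorable H k → StarColorable G (suc k)
starColorable-freshColor G H x G⊆H-offx (col , star@(proper , _)) =
  recolor ,
  starColoring-byKernel G recolor (λ u v → u ≢ x × v ≢ x × col u ≡ col v) recolor-kernel
    (λ u v (u≢x , v≢x , eq) uv → proper u v (G⊆H-offx u v u≢x v≢x uv) eq)
    (λ { a b c d (ab≢ , ac≢ , ad≢ , bc≢ , bd≢ , cd≢ , ab , bc , cd) (a≢x , c≢x , ac) (b≢x , d≢x , bd) →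
         starColoring⇒noAlternatingP4 H col star a b c d
           (ab≢ , ac≢ , ad≢ , bc≢ , bd≢ , cd≢ ,
            G⊆H-offx a b a≢x b≢x ab , G⊆H-offx b c b≢x c≢x bc , G⊆H-offx c d c≢x d≢x cd)
           ac bd })
  where open FreshColor x col

starColorable-deleteEdge : ∀ {n k} (G : Graph n) x y (xy : Adj G x y) →
  StarColorable (deleteEdge G x y xy) k → StarColorable G (suc k)
starColorable-deleteEdge G x y xy =
  starColorable-freshColor G (deleteEdge G x y xy) x
    (λ u v u≢x v≢x uv → uv , λ { (inj₁ (u≡x , _)) → u≢x u≡x ; (inj₂ (_ , v≡x)) → v≢x v≡x })

-- Saving colors by merging independent vertices

module Collapse {k : ℕ} {u v : Fin (suc k)} (u≢v : u ≢ v) where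

  collapse : Fin (suc k) → Fin k
  collapse z with z ≟ u
  ... | yes _ = punchOut u≢v
  ... | no z≢u = punchOut (≢-sym z≢u)

  collapse-kernel : ∀ z w → collapse z ≡ collapse w →
    z ≡ w ⊎ (z ∈ u ∷ v ∷ [] × w ∈ u ∷ v ∷ [])
  collapse-kernel z w eq with z ≟ u | w ≟ u
  ... | yes z≡u | yes w≡u = inj₁ (trans z≡u (sym w≡u))
  ... | yes z≡u | no w≢u =
    inj₂ (here z≡u , there (here (sym (punchOut-injective u≢v (≢-sym w≢u) eq))))
  ... | no z≢u | yes w≡u =
    inj₂ (there (here (punchOut-injective (≢-sym z≢u) u≢v eq)) , here w≡u)
  ... | no z≢u | no w≢u = inj₁ (punchOut-injective (≢-sym z≢u) (≢-sym w≢u) eq)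

  collapse-preimage : ∀ {z} ws → collapse z ∈ map collapse ws →
    z ∈ ws ⊎ (z ∈ u ∷ v ∷ [] × ∃[ s ] (s ∈ ws × s ∈ u ∷ v ∷ []))
  collapse-preimage {z} ws z∈ with ∈-map⁻ collapse z∈
  ... | s , s∈ws , eq with collapse-kernel z s eq
  ...   | inj₁ refl = inj₁ s∈ws
  ...   | inj₂ (z∈uv , s∈uv) = inj₂ (z∈uv , s , s∈ws , s∈uv)

Independent : ∀ {n} → Graph n → List (Fin n) → Set
Independent G vs = ∀ {z w} → z ∈ vs → w ∈ vs → ¬ Adj G z w

independent-[] : ∀ {n} (G : Graph n) → Independent G []
independent-[] G ()

independent-∷ : ∀ {n} (G : Graph n) {u} {vs} →
  (∀ {w} → w ∈ vs → ¬ Adj G u w) → Independent G vs → Independent G (u ∷ vs)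
independent-∷ G u≁vs vs-indep (here refl) (here refl) = irrefl G
independent-∷ G u≁vs vs-indep (here refl) (there w∈) = u≁vs w∈
independent-∷ G u≁vs vs-indep (there z∈) (here refl) = u≁vs z∈ ∘ Adj-sym G
independent-∷ G u≁vs vs-indep (there z∈) (there w∈) = vs-indep z∈ w∈

independent-pair : ∀ {n} (G : Graph n) {u v} → ¬ Adj G u v → Independent G (u ∷ v ∷ [])
independent-pair G u≁v =
  independent-∷ G (λ { (here refl) → u≁v }) (independent-∷ G (λ ()) (independent-[] G))

starColoring-oneIndependentClass : ∀ {n k} (G : Graph n) (col : Fin n → Fin k) (vs : List (Fin n)) →
  Independent G vs → (∀ z w → col z ≡ col w → z ≡ w ⊎ (z ∈ vs × w ∈ vs)) →
  StarColoring G col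
starColoring-oneIndependentClass G col vs vs-indep kernel =
  starColoring-byKernel G col (λ z w → z ∈ vs × w ∈ vs) kernel
    (λ _ _ (z∈ , w∈) → vs-indep z∈ w∈)
    (λ { _ _ _ _ (_ , _ , _ , _ , _ , _ , ab , _) (a∈ , _) (b∈ , _) → vs-indep a∈ b∈ ab })

starColorable-nonAdjacentPair : ∀ {k} (G : Graph (suc k)) {u v} → u ≢ v → ¬ Adj G u v →
  StarColorable G k
starColorable-nonAdjacentPair G u≢v u≁v =
  collapse , starColoring-oneIndependentClass G collapse _ (independent-pair G u≁v) collapse-kernel
  where open Collapse u≢v

∉-pair : ∀ {n} {t u v : Fin n} → t ≢ u → t ≢ v → ¬ t ∈ u ∷ v ∷ []
∉-pair t≢u t≢v (here t≡u) = t≢u t≡u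
∉-pair t≢u t≢v (there (here t≡v)) = t≢v t≡v

collapse-≢ : ∀ {k} {u v : Fin (suc k)} (u≢v : u ≢ v) {s t} → s ≢ t → ¬ t ∈ u ∷ v ∷ [] →
  Collapse.collapse u≢v s ≢ Collapse.collapse u≢v t
collapse-≢ u≢v {s} {t} s≢t t∉uv eq with Collapse.collapse-kernel u≢v s t eq
... | inj₁ s≡t = s≢t s≡t
... | inj₂ (_ , t∈uv) = t∉uv t∈uv

module DoubleCollapse {k : ℕ} {u v s t : Fin (suc (suc k))} (u≢v : u ≢ v) (s≢t : s ≢ t)
                      (t∉uv : ¬ t ∈ u ∷ v ∷ []) where
  open Collapse u≢v
    using (collapse-preimage) renaming (collapse to collapse₁; collapse-kernel to collapse₁-kernel)
  open Collapse (collapse-≢ u≢v s≢t t∉uv)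
    using () renaming (collapse to collapse₂; collapse-kernel to collapse₂-kernel)

  collapse₂₁ : Fin (suc (suc k)) → Fin k
  collapse₂₁ = collapse₂ ∘ collapse₁

  -- z lies in the class of s or of t once u and v are merged.
  Merged₂ : Fin (suc (suc k)) → Set
  Merged₂ z = z ∈ s ∷ t ∷ [] ⊎ (z ∈ u ∷ v ∷ [] × ∃[ r ] (r ∈ s ∷ t ∷ [] × r ∈ u ∷ v ∷ []))

  collapse₂₁-kernel : ∀ z w → collapse₂₁ z ≡ collapse₂₁ w →
    z ≡ w ⊎ (z ∈ u ∷ v ∷ [] × w ∈ u ∷ v ∷ []) ⊎ (Merged₂ z × Merged₂ w)
  collapse₂₁-kernel z w eq with collapse₂-kernel (collapse₁ z) (collapse₁ w) eq
  ... | inj₂ (z∈ , w∈) =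
    inj₂ (inj₂ (collapse-preimage (s ∷ t ∷ []) z∈ , collapse-preimage (s ∷ t ∷ []) w∈))
  ... | inj₁ eq₁ with collapse₁-kernel z w eq₁
  ...   | inj₁ z≡w = inj₁ z≡w
  ...   | inj₂ both∈uv = inj₂ (inj₁ both∈uv)

adjacent-to-pair : ∀ {n} (G : Graph n) {u v x y z} → x ∈ u ∷ v ∷ [] → z ∈ u ∷ v ∷ [] → x ≢ z →
  Adj G x y → Adj G y z → Adj G y u × Adj G y v
adjacent-to-pair G (here refl) (here refl) x≢z _ _ = ⊥-elim (x≢z refl)
adjacent-to-pair G (here refl) (there (here refl)) _ xy yz = Adj-sym G xy , yz
adjacent-to-pair G (there (here refl)) (here refl) _ xy yz = yz , Adj-sym G xy
adjacent-to-pair G (there (here refl)) (there (here refl)) x≢z _ _ = ⊥-elim (x≢z refl)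

starColorable-I3 : ∀ {k} (G : Graph (suc (suc k))) → HasInducedI3 G → StarColorable G k
starColorable-I3 {k} G (a , b , c , a≢b , a≢c , b≢c , a≁b , a≁c , b≁c) =
  collapse₂₁ , starColoring-oneIndependentClass G collapse₂₁ abc abc-independent kernel
  where
  open DoubleCollapse a≢c a≢b (∉-pair (≢-sym a≢b) b≢c)
  abc : List (Fin (suc (suc k)))
  abc = a ∷ b ∷ c ∷ []
  abc-independent : Independent G abc
  abc-independent =
    independent-∷ G (λ { (here refl) → a≁b ; (there (here refl)) → a≁c }) (independent-pair G b≁c)
  ac⊆abc : ∀ {z} → z ∈ a ∷ c ∷ [] → z ∈ abc
  ac⊆abc (here z≡a) = here z≡a
  ac⊆abc (there (here z≡c)) = there (there (here z≡c))
  merged⊆abc : ∀ {z} → Merged₂ z → z ∈ abc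
  merged⊆abc (inj₁ (here z≡a)) = here z≡a
  merged⊆abc (inj₁ (there (here z≡b))) = there (here z≡b)
  merged⊆abc (inj₂ (z∈ac , _)) = ac⊆abc z∈ac
  kernel : ∀ z w → collapse₂₁ z ≡ collapse₂₁ w → z ≡ w ⊎ (z ∈ abc × w ∈ abc)
  kernel z w eq with collapse₂₁-kernel z w eq
  ... | inj₁ z≡w = inj₁ z≡w
  ... | inj₂ (inj₁ (z∈ , w∈)) = inj₂ (ac⊆abc z∈ , ac⊆abc w∈)
  ... | inj₂ (inj₂ (z∈ , w∈)) = inj₂ (merged⊆abc z∈ , merged⊆abc w∈)

starColorable-2K2 : ∀ {k} (G : Graph (suc (suc k))) → HasInduced2K2 G → StarColorable G k
starColorable-2K2 {k} G (a , b , c , d , a≢b , a≢c , a≢d , b≢c , b≢d , c≢d , a~b , c~d , a≁c , a≁d , b≁c , b≁d) =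
  collapse₂₁ , starColoring-byKernel G collapse₂₁ SameClass kernel nonadjacent noP4
  where
  open DoubleCollapse a≢c b≢d (∉-pair (≢-sym a≢d) (≢-sym c≢d))
  ac bd : List (Fin (suc (suc k)))
  ac = a ∷ c ∷ []
  bd = b ∷ d ∷ []
  SameClass : Fin (suc (suc k)) → Fin (suc (suc k)) → Set
  SameClass z w = (z ∈ ac × w ∈ ac) ⊎ (z ∈ bd × w ∈ bd)
  merged⇒∈bd : ∀ {z} → Merged₂ z → z ∈ bd
  merged⇒∈bd (inj₁ z∈bd) = z∈bd
  merged⇒∈bd (inj₂ (_ , _ , here refl , b∈ac)) = ⊥-elim (∉-pair (≢-sym a≢b) b≢c b∈ac)
  merged⇒∈bd (inj₂ (_ , _ , there (here refl) , d∈ac)) = ⊥-elim (∉-pair (≢-sym a≢d) (≢-sym c≢d) d∈ac)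
  kernel : ∀ z w → collapse₂₁ z ≡ collapse₂₁ w → z ≡ w ⊎ SameClass z w
  kernel z w eq with collapse₂₁-kernel z w eq
  ... | inj₁ z≡w = inj₁ z≡w
  ... | inj₂ (inj₁ both∈ac) = inj₂ (inj₁ both∈ac)
  ... | inj₂ (inj₂ (z∈ , w∈)) = inj₂ (inj₂ (merged⇒∈bd z∈ , merged⇒∈bd w∈))
  nonadjacent : ∀ z w → SameClass z w → ¬ Adj G z w
  nonadjacent _ _ (inj₁ (z∈ , w∈)) = independent-pair G a≁c z∈ w∈
  nonadjacent _ _ (inj₂ (z∈ , w∈)) = independent-pair G b≁d z∈ w∈
  bd-notAdjacentTo-ac : ∀ {y} → y ∈ bd → ¬ (Adj G y a × Adj G y c)
  bd-notAdjacentTo-ac (here refl) (_ , b~c) = b≁c b~c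
  bd-notAdjacentTo-ac (there (here refl)) (d~a , _) = a≁d (Adj-sym G d~a)
  ac-notAdjacentTo-bd : ∀ {y} → y ∈ ac → ¬ (Adj G y b × Adj G y d)
  ac-notAdjacentTo-bd (here refl) (_ , a~d) = a≁d a~d
  ac-notAdjacentTo-bd (there (here refl)) (c~b , _) = b≁c (Adj-sym G c~b)
  noP4 : ∀ p q r s → IsP4 G p q r s → SameClass p r → SameClass q s → ⊥
  noP4 p q r s (_ , p≢r , _ , _ , _ , _ , pq , qr , _) = λ where
    (inj₁ (p∈ , r∈)) (inj₁ (q∈ , _)) → nonadjacent p q (inj₁ (p∈ , q∈)) pq
    (inj₂ (p∈ , r∈)) (inj₂ (q∈ , _)) → nonadjacent p q (inj₂ (p∈ , q∈)) pq
    (inj₁ (p∈ , r∈)) (inj₂ (q∈ , _)) → bd-notAdjacentTo-ac q∈ (adjacent-to-pair G p∈ r∈ p≢r pq qr)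
    (inj₂ (p∈ , r∈)) (inj₁ (q∈ , _)) → ac-notAdjacentTo-bd q∈ (adjacent-to-pair G p∈ r∈ p≢r pq qr)

-- Fewer colors force an induced I3 or 2K2

MonochromaticTriple : ∀ {n k} → (Fin n → Fin k) → Set
MonochromaticTriple col = ∃[ p ] ∃[ q ] ∃[ r ]
  (p ≢ q × p ≢ r × q ≢ r × col p ≡ col q × col p ≡ col r)

DisjointMonochromaticPairs : ∀ {n k} → (Fin n → Fin k) → Set
DisjointMonochromaticPairs col = ∃[ p ] ∃[ q ] ∃[ r ] ∃[ s ]
  (p ≢ q × p ≢ r × p ≢ s × q ≢ r × q ≢ s × r ≢ s × col p ≡ col q × col r ≡ col s)

triple-or-disjointPairs : ∀ {k} (col : Fin (suc (suc k)) → Fin k) →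
  MonochromaticTriple col ⊎ DisjointMonochromaticPairs col
triple-or-disjointPairs col with pigeonhole (n≤1+n _) col
... | i , j , i<j , ci≡cj with pigeonhole (n<1+n _) (col ∘ punchIn i)
...   | i′ , j′ , i′<j′ , ca≡cb =
  fromCollisions (<⇒≢ i<j) (<⇒≢ i′<j′ ∘ punchIn-injective i i′ j′)
    (punchInᵢ≢i i i′) (punchInᵢ≢i i j′) ci≡cj ca≡cb
  where
  fromCollisions : ∀ {i j a b} → i ≢ j → a ≢ b → a ≢ i → b ≢ i → col i ≡ col j → col a ≡ col b →
    MonochromaticTriple col ⊎ DisjointMonochromaticPairs col
  fromCollisions {i} {j} {a} {b} i≢j a≢b a≢i b≢i ci≡cj ca≡cb with col i ≟ col a
  ... | yes ci≡ca = inj₁ (i , a , b , ≢-sym a≢i , ≢-sym b≢i , a≢b , ci≡ca , trans ci≡ca ca≡cb)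
  ... | no ci≢ca = inj₂ (i , j , a , b , i≢j , ≢-sym a≢i , ≢-sym b≢i , j≢a , j≢b , a≢b , ci≡cj , ca≡cb)
    where
    j≢a : j ≢ a
    j≢a j≡a = ci≢ca (trans ci≡cj (cong col j≡a))
    j≢b : j ≢ b
    j≢b j≡b = ci≢ca (trans ci≡cj (trans (cong col j≡b) (sym ca≡cb)))

module _ {n k : ℕ} (G : Graph n) {col : Fin n → Fin k} where

  monochromaticTriple⇒I3 : ProperColoring G col → MonochromaticTriple col → HasInducedI3 G
  monochromaticTriple⇒I3 proper (p , q , r , p≢q , p≢r , q≢r , cp≡cq , cp≡cr) =
    p , q , r , p≢q , p≢r , q≢r ,
    (λ pq → proper p q pq cp≡cq) , (λ pr → proper p r pr cp≡cr) ,
    (λ qr → proper q r qr (trans (sym cp≡cq) cp≡cr))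

  -- A vertex with no neighbour in the other pair gives an I3, a perfect
  -- matching between the pairs a 2K2, and three or four edges between the
  -- pairs contain a P4 alternating between their two colors.
  disjointPairs⇒I3⊎2K2 : StarColoring G col → DisjointMonochromaticPairs col →
    HasInducedI3 G ⊎ HasInduced2K2 G
  disjointPairs⇒I3⊎2K2 star@(proper , _) (p , q , r , s , p≢q , p≢r , p≢s , q≢r , q≢s , r≢s , cpq , crs) =
    crossEdges (dec G p r) (dec G p s) (dec G q r) (dec G q s)
    where
    noAlt : NoAlternatingP4 G col
    noAlt = starColoring⇒noAlternatingP4 G col star
    p≁q : ¬ Adj G p q
    p≁q pq = proper p q pq cpq
    r≁s : ¬ Adj G r s
    r≁s rs = proper r s rs crs
    crossEdges : Dec (Adj G p r) → Dec (Adj G p s) → Dec (Adj G q r) → Dec (Adj G q s) →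
      HasInducedI3 G ⊎ HasInduced2K2 G
    crossEdges (yes p~r) (yes p~s) _ (yes q~s) =
      ⊥-elim (noAlt r p s q (≢-sym p≢r , r≢s , ≢-sym q≢r , p≢s , p≢q , ≢-sym q≢s ,
                             Adj-sym G p~r , p~s , Adj-sym G q~s) crs cpq)
    crossEdges (yes p~r) (yes p~s) (yes q~r) (no _) =
      ⊥-elim (noAlt s p r q (≢-sym p≢s , ≢-sym r≢s , ≢-sym q≢s , p≢r , p≢q , ≢-sym q≢r ,
                             Adj-sym G p~s , p~r , Adj-sym G q~r) (sym crs) cpq)
    crossEdges (yes _) (yes _) (no q≁r) (no q≁s) = inj₁ (q , r , s , q≢r , q≢s , r≢s , q≁r , q≁s , r≁s)
    crossEdges (yes p~r) (no _) (yes q~r) (yes q~s) =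
      ⊥-elim (noAlt p r q s (p≢r , p≢q , p≢s , ≢-sym q≢r , r≢s , q≢s ,
                             p~r , Adj-sym G q~r , q~s) cpq crs)
    crossEdges _ (no p≁s) _ (no q≁s) = inj₁ (p , q , s , p≢q , p≢s , q≢s , p≁q , p≁s , q≁s)
    crossEdges (yes p~r) (no p≁s) (no q≁r) (yes q~s) =
      inj₂ (p , r , q , s , p≢r , p≢q , p≢s , ≢-sym q≢r , r≢s , q≢s , p~r , q~s ,
            p≁q , p≁s , q≁r ∘ Adj-sym G , r≁s)
    crossEdges (no _) (yes p~s) (yes q~r) (yes q~s) =
      ⊥-elim (noAlt p s q r (p≢s , p≢q , p≢r , ≢-sym q≢s , ≢-sym r≢s , q≢r ,
                             p~s , Adj-sym G q~s , q~r) cpq (sym crs))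
    crossEdges (no p≁r) (yes p~s) (yes q~r) (no q≁s) =
      inj₂ (p , s , q , r , p≢s , p≢q , p≢r , ≢-sym q≢s , ≢-sym r≢s , q≢r , p~s , q~r ,
            p≁q , p≁r , q≁s ∘ Adj-sym G , r≁s ∘ Adj-sym G)
    crossEdges (no p≁r) _ (no q≁r) _ = inj₁ (p , q , r , p≢q , p≢r , q≢r , p≁q , p≁r , q≁r)
    crossEdges (no p≁r) (no p≁s) _ _ = inj₁ (p , r , s , p≢r , p≢s , r≢s , p≁r , p≁s , r≁s)

starColorable⇒I3⊎2K2 : ∀ {k} (G : Graph (suc (suc k))) → StarColorable G k →
  HasInducedI3 G ⊎ HasInduced2K2 G
starColorable⇒I3⊎2K2 G (col , star@(proper , _)) =
  [ inj₁ ∘ monochromaticTriple⇒I3 G proper , disjointPairs⇒I3⊎2K2 G star ] (triple-or-disjointPairs col)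

I3⊎2K2⇒starColorable : ∀ {k} (G : Graph (suc (suc k))) → HasInducedI3 G ⊎ HasInduced2K2 G →
  StarColorable G k
I3⊎2K2⇒starColorable G = [ starColorable-I3 G , starColorable-2K2 G ]

nonAdjacentPair : ∀ {n} (G : Graph n) → ¬ Complete G → ∃[ u ] ∃[ v ] (u ≢ v × ¬ Adj G u v)
nonAdjacentPair G incomplete with any? (λ u → any? (λ v → ¬? (u ≟ v) ×-dec ¬? (dec G u v)))
... | yes found = found
... | no none = ⊥-elim (incomplete complete)
  where
  complete : Complete G
  complete u v u≢v with dec G u v
  ... | yes uv = uv
  ... | no u≁v = ⊥-elim (none (u , v , u≢v , u≁v))

starChromatic-suc : ∀ {n k} (G : Graph n) → StarColorable G (suc k) → ¬ StarColorable G k →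
  StarChromatic G (suc k)
starChromatic-suc G colorable notColorable =
  colorable , λ m m<1+k → notColorable ∘ starColorable-mono G (s≤s⁻¹ m<1+k)

EdgeDeletionsCreateI3or2K2 : ∀ {n} → Graph n → Set
EdgeDeletionsCreateI3or2K2 G =
  ∀ x y (e : Adj G x y) → HasInducedI3 (deleteEdge G x y e) ⊎ HasInduced2K2 (deleteEdge G x y e)

critical⇔I3-2K2-free : ∀ {k} (G : Graph (suc (suc k))) → ¬ Complete G →
  Critical G (suc k) ⇔ (I3-2K2-Free G × EdgeDeletionsCreateI3or2K2 G)
critical⇔I3-2K2-free {k} G incomplete = mk⇔ critical⇒ ⇒critical
  where
  not-k-colorable⇒free : ¬ StarColorable G k → I3-2K2-Free G
  not-k-colorable⇒free notColorable =
    notColorable ∘ I3⊎2K2⇒starColorable G ∘ inj₁ , notColorable ∘ I3⊎2K2⇒starColorable G ∘ inj₂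

  free⇒not-k-colorable : I3-2K2-Free G → ¬ StarColorable G k
  free⇒not-k-colorable (noI3 , no2K2) = [ noI3 , no2K2 ] ∘ starColorable⇒I3⊎2K2 G

  critical⇒ : Critical G (suc k) → I3-2K2-Free G × EdgeDeletionsCreateI3or2K2 G
  critical⇒ ((_ , minimal) , edgeCritical) =
    not-k-colorable⇒free (minimal k (n<1+n k)) ,
    λ x y e → let (m , m<1+k , (colorable , _)) = edgeCritical x y e in
      starColorable⇒I3⊎2K2 (deleteEdge G x y e)
        (starColorable-mono (deleteEdge G x y e) (s≤s⁻¹ m<1+k) colorable)

  ⇒critical : I3-2K2-Free G × EdgeDeletionsCreateI3or2K2 G → Critical G (suc k)
  ⇒critical (free , edges) =
    starChromatic-suc G 1+k-colorable (free⇒not-k-colorable free) , edgeCritical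
    where
    1+k-colorable : StarColorable G (suc k)
    1+k-colorable =
      let (u , v , u≢v , u≁v) = nonAdjacentPair G incomplete in starColorable-nonAdjacentPair G u≢v u≁v
    edgeCritical : ∀ x y (e : Adj G x y) → ∃[ m ] (m < suc k × StarChromatic (deleteEdge G x y e) m)
    edgeCritical x y e =
      k , n<1+n k ,
      I3⊎2K2⇒starColorable (deleteEdge G x y e) (edges x y e) ,
      λ m m<k colorable →
        free⇒not-k-colorable free (starColorable-mono G m<k (starColorable-deleteEdge G x y e colorable))

mainTheorem2 : (n : ℕ) → 5 ≤ n → (G : Graph n) → Connected G → ¬ Complete G →
    Critical G (n ∸ 1) ⇔
      (I3-2K2-Free G ×
       (∀ x y (e : Adj G x y) →
          HasInducedI3 (deleteEdge G x y e) ⊎ HasInduced2K2 (deleteEdge G x y e)))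
mainTheorem2 (suc zero) (s≤s ())
mainTheorem2 (suc (suc k)) _ G _ = critical⇔I3-2K2-free G
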